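{- For integers $m,n\geq 1$, let $\delta_{m,n}$ be the number of $3$-element subsets of $V(H_{1\times m\times n})$ that induce a path $P_3$ (equivalently, a connected induced subgraph) in $H_{1\times m\times n}$. Then $\delta_{m,n}=6mn+2m+2n-4$.
   Context: The hexagonal grid graph $H_{1\times m\times n}$ is the graph of vertices and edges of a parallelogram-shaped patch of the regular hexagonal (honeycomb) tiling of the plane consisting of $m\times n$ hexagons: in axial coordinates, take the hexagons $(p,q)$ with $p\in\{1,\dots,m\}$, $q\in\{1,\dots,n\}$, where hexagon $(p,q)$ shares an edge with $(p\pm1,q)$, $(p,q\pm1)$, $(p+1,q-1)$, $(p-1,q+1)$; $H_{1\times m\times n}$ has as vertices all corners of these hexagons and as edges all sides of these hexagons. It has $2m+2n+2mn$ vertices. -}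

module Defs where

open import Data.Bool using (Bool; true; false; _∧_; _∨_; if_then_else_)
open import Data.Nat using (ℕ; zero; suc; _+_; _*_; _∸_; _≤ᵇ_; _≡ᵇ_)
open import Data.List using (List; []; _∷_; map; concatMap; length; upTo; _++_)
open import Data.Product using (_×_; _,_)

-- Hexagons are cells (p , q) of the triangular lattice of hexagon centres
-- (axial coordinates); hexagon (p,q) neighbours (p±1,q), (p,q±1),
-- (p+1,q-1), (p-1,q+1).  A corner of the honeycomb is the common point of
-- three mutually adjacent hexagons, i.e. a triangle of that lattice:
--   up   (p , q) : cells (p,q), (p+1,q), (p,q+1)
--   down (p , q) : cells (p+1,q), (p,q+1), (p+1,q+1)
-- A side of the honeycomb is shared by exactly two adjacent hexagons and
-- joins the two triangles containing both of them.

bfilter : {A : Set} → (A → Bool) → List A → List A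
bfilter f []       = []
bfilter f (x ∷ xs) = if f x then x ∷ bfilter f xs else bfilter f xs

bany : {A : Set} → (A → Bool) → List A → Bool
bany f []       = false
bany f (x ∷ xs) = f x ∨ bany f xs

Cell : Set
Cell = ℕ × ℕ

data Tri : Set where
  up   : ℕ → ℕ → Tri
  down : ℕ → ℕ → Tri

cellsOf : Tri → List Cell
cellsOf (up p q)   = (p , q) ∷ (suc p , q) ∷ (p , suc q) ∷ []
cellsOf (down p q) = (suc p , q) ∷ (p , suc q) ∷ (suc p , suc q) ∷ []

cellEq : Cell → Cell → Bool
cellEq (a , b) (c , d) = (a ≡ᵇ c) ∧ (b ≡ᵇ d)

triEq : Tri → Tri → Bool
triEq (up a b)   (up c d)   = (a ≡ᵇ c) ∧ (b ≡ᵇ d)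
triEq (down a b) (down c d) = (a ≡ᵇ c) ∧ (b ≡ᵇ d)
triEq _          _          = false

inPatch : ℕ → ℕ → Cell → Bool
inPatch m n (p , q) = (1 ≤ᵇ p) ∧ (p ≤ᵇ m) ∧ (1 ≤ᵇ q) ∧ (q ≤ᵇ n)

isVertex : ℕ → ℕ → Tri → Bool
isVertex m n t = bany (inPatch m n) (cellsOf t)

sharedCells : Tri → Tri → List Cell
sharedCells t t' = bfilter (λ c → bany (cellEq c) (cellsOf t')) (cellsOf t)

-- t and t' are joined by a side of a hexagon of the patch: they share a
-- lattice edge (two hexagons) and one of these two hexagons is in the patch
adjacent : ℕ → ℕ → Tri → Tri → Bool
adjacent m n t t' =
  (length (sharedCells t t') ≡ᵇ 2) ∧ bany (inPatch m n) (sharedCells t t')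

-- All triangles in a range large enough to contain every vertex, filtered.
allTris : ℕ → ℕ → List Tri
allTris m n =
  concatMap (λ p → concatMap (λ q → up p q ∷ down p q ∷ []) (upTo (suc (suc n))))
            (upTo (suc (suc m)))

vertices : ℕ → ℕ → List Tri
vertices m n = bfilter (isVertex m n) (allTris m n)

-- all k-element sublists (= k-element subsets of a duplicate-free list)
combinations : {A : Set} → ℕ → List A → List (List A)
combinations zero    _        = [] ∷ []
combinations (suc k) []       = []
combinations (suc k) (x ∷ xs) =
  map (x ∷_) (combinations k xs) ++ combinations (suc k) xs

b2n : Bool → ℕ
b2n true  = 1
b2n false = 0

inducesP3 : ℕ → ℕ → List Tri → Bool
inducesP3 m n (a ∷ b ∷ c ∷ []) =
  (b2n (adjacent m n a b) + b2n (adjacent m n a c) + b2n (adjacent m n b c)) ≡ᵇ 2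
inducesP3 m n _ = false

δ : ℕ → ℕ → ℕ
δ m n = length (bfilter (inducesP3 m n) (combinations 3 (vertices m n)))

{-# OPTIONS --safe #-}
-- The corners of the patch are the lattice triangles up (p , q) and down (p , q), and every
-- side joins an up-triangle to a down-triangle, so the graph is bipartite, hence triangle-free.
-- A 3-set therefore induces P₃ exactly when it is a path x – v – y, and counting such paths by
-- their middle vertex gives δ = Σ_v C(deg v, 2).  The up-triangle (a , b) can only be adjacent
-- to the down-triangles (a , b), (a - 1 , b) and (a , b - 1), across the side separating the two
-- hexagons they share, and that side is present iff one of those hexagons is in the patch.  So
-- the contribution of the corners up/down (p , q) depends on p only through its zone
-- (p = 0, 1 ≤ p < m, p = m, p = m + 1), and likewise for q: δ is a 4 × 4 table of local counts
-- weighted by 1, m - 1, 1, 1 in one direction and by 1, n - 1, 1, 1 in the other.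

module Submission where

open import Data.Bool using (Bool; true; false; T; _∧_; _∨_)
open import Data.Bool.Properties using (T-∧; T-∨; T-≡; ∧-zeroʳ)
open import Function.Base using (id)
open import Function.Bundles using (module Equivalence)
open Equivalence using (to; from)
open import Data.List using (List; []; _∷_; _++_; map; concatMap; length; applyUpTo; upTo)
open import Data.List.Properties using (map-++; map-∘; map-cong; length-map)
open import Data.Nat
  using (ℕ; zero; suc; pred; _+_; _*_; _∸_; _≥_; _<_; _≡ᵇ_; _<ᵇ_; _≤ᵇ_; s≤s; z≤n)
open import Data.Nat.Combinatorics using (_C_; nC1≡n; nCk+nC[k+1]≡[n+1]C[k+1])
open import Data.Nat.ListAction using (sum)
open import Data.Nat.ListAction.Properties using (sum-++)
open import Data.Nat.Properties
open import Data.Nat.Tactic.RingSolver using (solve-∀)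
open import Data.Product using (_,_; proj₂)
open import Data.Sum using (_⊎_; inj₁; inj₂)
open import Relation.Binary.PropositionalEquality
open ≡-Reasoning
open import Algebra.Properties.CommutativeSemigroup +-commutativeSemigroup
  using () renaming (interchange to +-interchange)

open import Defs

private variable
  A B : Set

∑ : List A → (A → ℕ) → ℕ
∑ xs f = sum (map f xs)

∑-++ : (xs ys : List A) (f : A → ℕ) → ∑ (xs ++ ys) f ≡ ∑ xs f + ∑ ys f
∑-++ xs ys f = trans (cong sum (map-++ f xs ys)) (sum-++ (map f xs) (map f ys))

∑-cong : (xs : List A) {f g : A → ℕ} → (∀ x → f x ≡ g x) → ∑ xs f ≡ ∑ xs g
∑-cong xs f≗g = cong sum (map-cong f≗g xs)

∑-map : (g : A → B) (xs : List A) (f : B → ℕ) → ∑ (map g xs) f ≡ ∑ xs (λ x → f (g x))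
∑-map g xs f = cong sum (sym (map-∘ {g = f} {f = g} xs))

∑-concatMap : (g : A → List B) (xs : List A) (f : B → ℕ) →
  ∑ (concatMap g xs) f ≡ ∑ xs (λ x → ∑ (g x) f)
∑-concatMap g []       f = refl
∑-concatMap g (x ∷ xs) f = trans (∑-++ (g x) _ f) (cong (∑ (g x) f +_) (∑-concatMap g xs f))

∑-+ : (xs : List A) (f g : A → ℕ) → ∑ xs (λ x → f x + g x) ≡ ∑ xs f + ∑ xs g
∑-+ []       f g = refl
∑-+ (x ∷ xs) f g = trans (cong (f x + g x +_) (∑-+ xs f g)) (+-interchange (f x) (g x) _ _)

∑-*ˡ : (xs : List A) (c : ℕ) (f : A → ℕ) → ∑ xs (λ x → c * f x) ≡ c * ∑ xs f
∑-*ˡ []       c f = sym (*-zeroʳ c)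
∑-*ˡ (x ∷ xs) c f = trans (cong (c * f x +_) (∑-*ˡ xs c f)) (sym (*-distribˡ-+ c (f x) _))

∑-bfilter : (p : A → Bool) (xs : List A) (f : A → ℕ) →
  ∑ (bfilter p xs) f ≡ ∑ xs (λ x → b2n (p x) * f x)
∑-bfilter p []       f = refl
∑-bfilter p (x ∷ xs) f with p x
... | true  = cong₂ _+_ (sym (+-identityʳ (f x))) (∑-bfilter p xs f)
... | false = ∑-bfilter p xs f

length-bfilter : (p : A → Bool) (xs : List A) → length (bfilter p xs) ≡ ∑ xs (λ x → b2n (p x))
length-bfilter p []       = refl
length-bfilter p (x ∷ xs) with p x
... | true  = cong suc (length-bfilter p xs)
... | false = length-bfilter p xs

∑-combinations-∷ : ∀ k (x : A) xs (F : List A → ℕ) →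
  ∑ (combinations (suc k) (x ∷ xs)) F
  ≡ ∑ (combinations k xs) (λ l → F (x ∷ l)) + ∑ (combinations (suc k) xs) F
∑-combinations-∷ k x xs F = trans (∑-++ (map (x ∷_) (combinations k xs)) _ F)
  (cong (_+ _) (∑-map (x ∷_) (combinations k xs) F))

∑pairs : List A → (A → A → ℕ) → ℕ
∑pairs []       h = 0
∑pairs (x ∷ xs) h = ∑ xs (h x) + ∑pairs xs h

∑triples : List A → (A → A → A → ℕ) → ℕ
∑triples []       h = 0
∑triples (x ∷ xs) h = ∑pairs xs (h x) + ∑triples xs h

∑-combinations₁ : (xs : List A) (F : List A → ℕ) →
  ∑ (combinations 1 xs) F ≡ ∑ xs (λ x → F (x ∷ []))
∑-combinations₁ []       F = refl
∑-combinations₁ (x ∷ xs) F = cong (F (x ∷ []) +_) (∑-combinations₁ xs F)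

∑-combinations₂ : (xs : List A) (F : List A → ℕ) →
  ∑ (combinations 2 xs) F ≡ ∑pairs xs (λ x y → F (x ∷ y ∷ []))
∑-combinations₂ []       F = refl
∑-combinations₂ (x ∷ xs) F = trans (∑-combinations-∷ 1 x xs F)
  (cong₂ _+_ (∑-combinations₁ xs (λ l → F (x ∷ l))) (∑-combinations₂ xs F))

∑-combinations₃ : (xs : List A) (F : List A → ℕ) →
  ∑ (combinations 3 xs) F ≡ ∑triples xs (λ x y z → F (x ∷ y ∷ z ∷ []))
∑-combinations₃ []       F = refl
∑-combinations₃ (x ∷ xs) F = trans (∑-combinations-∷ 2 x xs F)
  (cong₂ _+_ (∑-combinations₂ xs (λ l → F (x ∷ l))) (∑-combinations₃ xs F))

∑pairs-cong : (xs : List A) {f g : A → A → ℕ} → (∀ x y → f x y ≡ g x y) →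
  ∑pairs xs f ≡ ∑pairs xs g
∑pairs-cong []       f≗g = refl
∑pairs-cong (x ∷ xs) f≗g = cong₂ _+_ (∑-cong xs (f≗g x)) (∑pairs-cong xs f≗g)

∑pairs-+ : (xs : List A) (f g : A → A → ℕ) →
  ∑pairs xs (λ x y → f x y + g x y) ≡ ∑pairs xs f + ∑pairs xs g
∑pairs-+ []       f g = refl
∑pairs-+ (x ∷ xs) f g =
  trans (cong₂ _+_ (∑-+ xs (f x) (g x)) (∑pairs-+ xs f g)) (+-interchange (∑ xs (f x)) _ _ _)

suc-C2 : ∀ d → suc d C 2 ≡ d + d C 2
suc-C2 d = trans (sym (nCk+nC[k+1]≡[n+1]C[k+1] d 1)) (cong (_+ d C 2) (nC1≡n d))

b2n+-C2 : ∀ u d → (b2n u + d) C 2 ≡ b2n u * d + d C 2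
b2n+-C2 false d = refl
b2n+-C2 true  d = trans (suc-C2 d) (cong (_+ d C 2) (sym (*-identityˡ d)))

∑pairs-choose2 : (a : A → Bool) (xs : List A) →
  ∑pairs xs (λ x y → b2n (a x) * b2n (a y)) ≡ ∑ xs (λ x → b2n (a x)) C 2
∑pairs-choose2 a []       = refl
∑pairs-choose2 a (x ∷ xs) = begin
  ∑ xs (λ y → b2n (a x) * b2n (a y)) + ∑pairs xs (λ y z → b2n (a y) * b2n (a z))
    ≡⟨ cong₂ _+_ (∑-*ˡ xs (b2n (a x)) (λ y → b2n (a y))) (∑pairs-choose2 a xs) ⟩
  b2n (a x) * ∑ xs (λ y → b2n (a y)) + ∑ xs (λ y → b2n (a y)) C 2
    ≡⟨ b2n+-C2 (a x) _ ⟨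
  ∑ (x ∷ xs) (λ y → b2n (a y)) C 2 ∎

twoOfThree : ∀ u v w → u ∧ v ∧ w ≡ false →
  b2n ((b2n u + b2n v + b2n w) ≡ᵇ 2) ≡ b2n u * b2n v + (b2n u + b2n v) * b2n w
twoOfThree true  true  true  ()
twoOfThree true  true  false _ = refl
twoOfThree true  false true  _ = refl
twoOfThree true  false false _ = refl
twoOfThree false true  true  _ = refl
twoOfThree false true  false _ = refl
twoOfThree false false true  _ = refl
twoOfThree false false false _ = refl

pigeonhole-Bool : ∀ (b c d : Bool) → b ≡ c ⊎ b ≡ d ⊎ c ≡ d
pigeonhole-Bool true  true  _     = inj₁ refl
pigeonhole-Bool false false _     = inj₁ refl
pigeonhole-Bool true  false true  = inj₂ (inj₁ refl)
pigeonhole-Bool false true  false = inj₂ (inj₁ refl)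
pigeonhole-Bool true  false false = inj₂ (inj₂ refl)
pigeonhole-Bool false true  true  = inj₂ (inj₂ refl)

module BipartiteGraph {V : Set} (adj : V → V → Bool) (colour : V → Bool)
  (adj-sym : ∀ x y → adj x y ≡ adj y x)
  (adj-bipartite : ∀ x y → colour x ≡ colour y → adj x y ≡ false) where

  e : V → V → ℕ
  e x y = b2n (adj x y)

  degree : List V → V → ℕ
  degree L v = ∑ L (e v)

  twoEdges : V → V → V → Bool
  twoEdges x y z = (e x y + e x z + e y z) ≡ᵇ 2

  adj-irrefl : ∀ x → adj x x ≡ false
  adj-irrefl x = adj-bipartite x x refl

  triangleFree : ∀ x y z → adj x y ∧ adj x z ∧ adj y z ≡ false
  triangleFree x y z with pigeonhole-Bool (colour x) (colour y) (colour z)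
  ... | inj₁ cx≡cy        rewrite adj-bipartite x y cx≡cy = refl
  ... | inj₂ (inj₁ cx≡cz) rewrite adj-bipartite x z cx≡cz = ∧-zeroʳ (adj x y)
  ... | inj₂ (inj₂ cy≡cz)
    rewrite adj-bipartite y z cy≡cz | ∧-zeroʳ (adj x z) = ∧-zeroʳ (adj x y)

  ∑pairs-paths : (a : V → Bool) (xs : List V) →
    ∑pairs xs (λ y z → (b2n (a y) + b2n (a z)) * e y z) ≡ ∑ xs (λ v → b2n (a v) * degree xs v)
  ∑pairs-paths a []       = refl
  ∑pairs-paths a (x ∷ xs) = begin
    ∑ xs (λ z → (α x + α z) * e x z) + ∑pairs xs (λ y z → (α y + α z) * e y z)
      ≡⟨ cong₂ _+_ (trans (∑-cong xs (λ z → *-distribʳ-+ (e x z) (α x) (α z))) (∑-+ xs _ _))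
                   (∑pairs-paths a xs) ⟩
    ∑ xs (λ z → α x * e x z) + ∑ xs (λ z → α z * e x z) + ∑ xs (λ v → α v * degree xs v)
      ≡⟨ cong₂ (λ s t → s + t + ∑ xs (λ v → α v * degree xs v)) (∑-*ˡ xs (α x) (e x))
                   (∑-cong xs (λ z → cong (λ b → α z * b2n b) (adj-sym x z))) ⟩
    α x * degree xs x + ∑ xs (λ v → α v * e v x) + ∑ xs (λ v → α v * degree xs v)
      ≡⟨ +-assoc (α x * degree xs x) _ _ ⟩
    α x * degree xs x + (∑ xs (λ v → α v * e v x) + ∑ xs (λ v → α v * degree xs v))
      ≡⟨ cong₂ _+_ (cong (λ b → α x * (b2n b + degree xs x)) (sym (adj-irrefl x)))
                   (trans (sym (∑-+ xs _ _)) (∑-cong xs (λ v → sym (*-distribˡ-+ (α v) (e v x) _)))) ⟩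
    α x * degree (x ∷ xs) x + ∑ xs (λ v → α v * degree (x ∷ xs) v) ∎
    where
    α : V → ℕ
    α v = b2n (a v)

  twoEdges-count : ∀ x y z → b2n (twoEdges x y z) ≡ e x y * e x z + (e x y + e x z) * e y z
  twoEdges-count x y z = twoOfThree (adj x y) (adj x z) (adj y z) (triangleFree x y z)

  pathsFrom : ∀ x xs →
    ∑pairs xs (λ y z → b2n (twoEdges x y z)) ≡ degree xs x C 2 + ∑ xs (λ v → e x v * degree xs v)
  pathsFrom x xs = trans (∑pairs-cong xs (twoEdges-count x)) (trans (∑pairs-+ xs _ _)
    (cong₂ _+_ (∑pairs-choose2 (adj x) xs) (∑pairs-paths (adj x) xs)))

  pathCount : ∀ L → ∑triples L (λ x y z → b2n (twoEdges x y z)) ≡ ∑ L (λ v → degree L v C 2)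
  pathCount []       = refl
  pathCount (x ∷ xs) = begin
    ∑pairs xs (λ y z → b2n (twoEdges x y z)) + ∑triples xs (λ x y z → b2n (twoEdges x y z))
      ≡⟨ cong₂ _+_ (pathsFrom x xs) (pathCount xs) ⟩
    degree xs x C 2 + ∑ xs (λ v → e x v * degree xs v) + ∑ xs (λ v → degree xs v C 2)
      ≡⟨ +-assoc (degree xs x C 2) _ _ ⟩
    degree xs x C 2 + (∑ xs (λ v → e x v * degree xs v) + ∑ xs (λ v → degree xs v C 2))
      ≡⟨ cong₂ _+_ (cong (λ b → (b2n b + degree xs x) C 2) (sym (adj-irrefl x)))
                   (sym (∑-+ xs _ _)) ⟩
    degree (x ∷ xs) x C 2 + ∑ xs (λ v → e x v * degree xs v + degree xs v C 2)
      ≡⟨ cong (degree (x ∷ xs) x C 2 +_) (∑-cong xs λ v →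
           trans (cong (λ b → b2n b * degree xs v + degree xs v C 2) (adj-sym x v))
                 (sym (b2n+-C2 (adj v x) (degree xs v)))) ⟩
    ∑ (x ∷ xs) (λ v → degree (x ∷ xs) v C 2) ∎

∑< : ℕ → (ℕ → ℕ) → ℕ
∑< zero    h = 0
∑< (suc k) h = h 0 + ∑< k (λ i → h (suc i))

∑-applyUpTo : ∀ k (g : ℕ → A) (f : A → ℕ) → ∑ (applyUpTo g k) f ≡ ∑< k (λ i → f (g i))
∑-applyUpTo zero    g f = refl
∑-applyUpTo (suc k) g f = cong (f (g 0) +_) (∑-applyUpTo k (λ i → g (suc i)) f)

∑<-cong : ∀ k {h h' : ℕ → ℕ} → (∀ i → h i ≡ h' i) → ∑< k h ≡ ∑< k h'
∑<-cong zero    h≗h' = refl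
∑<-cong (suc k) h≗h' = cong₂ _+_ (h≗h' 0) (∑<-cong k (λ i → h≗h' (suc i)))

∑<-+ : ∀ k (f g : ℕ → ℕ) → ∑< k (λ i → f i + g i) ≡ ∑< k f + ∑< k g
∑<-+ zero    f g = refl
∑<-+ (suc k) f g = trans (cong (f 0 + g 0 +_) (∑<-+ k _ _)) (+-interchange (f 0) (g 0) _ _)

∑<-zero : ∀ k → ∑< k (λ _ → 0) ≡ 0
∑<-zero zero    = refl
∑<-zero (suc k) = ∑<-zero k

keepIf : Bool → ℕ → ℕ
keepIf true  x = x
keepIf false x = 0

∑<-keepIf : ∀ k b (h : ℕ → ℕ) → ∑< k (λ i → keepIf b (h i)) ≡ keepIf b (∑< k h)
∑<-keepIf k true  h = refl
∑<-keepIf k false h = ∑<-zero k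

∑<-suc : ∀ k h → ∑< (suc k) h ≡ ∑< k h + h k
∑<-suc zero    h = +-identityʳ (h 0)
∑<-suc (suc k) h = trans (cong (h 0 +_) (∑<-suc k (λ i → h (suc i)))) (sym (+-assoc (h 0) _ _))

∑<-const : ∀ k h c → (∀ i → i < k → h i ≡ c) → ∑< k h ≡ k * c
∑<-const zero    h c h≡c = refl
∑<-const (suc k) h c h≡c =
  cong₂ _+_ (h≡c 0 (s≤s z≤n))
            (∑<-const k (λ i → h (suc i)) c (λ i i<k → h≡c (suc i) (s≤s i<k)))

keepIf-∧ : ∀ u v x → keepIf (u ∧ v) x ≡ keepIf u (keepIf v x)
keepIf-∧ true  v x = refl
keepIf-∧ false v x = refl

record Picks (k : ℕ) (u : ℕ → Bool) (a : ℕ) (valid : Bool) : Set where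
  field
    ∑<-picks : ∀ (h : ℕ → ℕ) → ∑< k (λ i → keepIf (u i) (h i)) ≡ keepIf valid (h a)

open Picks

picks-≡ᵇ : ∀ k a → Picks k (a ≡ᵇ_) a (a <ᵇ k)
∑<-picks (picks-≡ᵇ zero    a)       h = refl
∑<-picks (picks-≡ᵇ (suc k) zero)    h = trans (cong (h 0 +_) (∑<-zero k)) (+-identityʳ (h 0))
∑<-picks (picks-≡ᵇ (suc k) (suc a)) h = ∑<-picks (picks-≡ᵇ k a) (λ i → h (suc i))

picks-ᵇ≡ : ∀ k a → Picks k (_≡ᵇ a) a (a <ᵇ k)
∑<-picks (picks-ᵇ≡ zero    a)       h = refl
∑<-picks (picks-ᵇ≡ (suc k) zero)    h = trans (cong (h 0 +_) (∑<-zero k)) (+-identityʳ (h 0))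
∑<-picks (picks-ᵇ≡ (suc k) (suc a)) h = ∑<-picks (picks-ᵇ≡ k a) (λ i → h (suc i))

picks-pred : ∀ k a → Picks k (λ i → a ≡ᵇ suc i) (pred a) ((1 ≤ᵇ a) ∧ (a ≤ᵇ k))
∑<-picks (picks-pred zero    zero)          h = refl
∑<-picks (picks-pred zero    (suc a))       h = refl
∑<-picks (picks-pred (suc k) zero)          h = ∑<-zero (suc k)
∑<-picks (picks-pred (suc k) (suc zero))    h =
  trans (cong (h 0 +_) (∑<-zero k)) (+-identityʳ (h 0))
∑<-picks (picks-pred (suc k) (suc (suc a))) h = ∑<-picks (picks-pred k (suc a)) (λ i → h (suc i))

picks-∧ : ∀ {k l u v a b U W} → Picks k u a U → Picks l v b W →
  ∀ (h : ℕ → ℕ → ℕ) →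
  ∑< k (λ i → ∑< l (λ j → keepIf (u i ∧ v j) (h i j))) ≡ keepIf U (keepIf W (h a b))
picks-∧ {k} {l} {u} {v} {a} {b} {U} {W} pu pv h = begin
  ∑< k (λ i → ∑< l (λ j → keepIf (u i ∧ v j) (h i j)))
    ≡⟨ ∑<-cong k (λ i → trans (∑<-cong l (λ j → keepIf-∧ (u i) (v j) (h i j)))
                              (∑<-keepIf l (u i) _)) ⟩
  ∑< k (λ i → keepIf (u i) (∑< l (λ j → keepIf (v j) (h i j))))
    ≡⟨ ∑<-picks pu _ ⟩
  keepIf U (∑< l (λ j → keepIf (v j) (h a j)))
    ≡⟨ cong (keepIf U) (∑<-picks pv (h a)) ⟩
  keepIf U (keepIf W (h a b)) ∎

∑<∑<-+ : ∀ k l (f g : ℕ → ℕ → ℕ) →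
  ∑< k (λ i → ∑< l (λ j → f i j + g i j))
  ≡ ∑< k (λ i → ∑< l (f i)) + ∑< k (λ i → ∑< l (g i))
∑<∑<-+ k l f g = trans (∑<-cong k (λ i → ∑<-+ l (f i) (g i))) (∑<-+ k _ _)

picks-∧₃ : ∀ {k l u₁ v₁ u₂ v₂ u₃ v₃ a₁ b₁ a₂ b₂ a₃ b₃ U₁ W₁ U₂ W₂ U₃ W₃} →
  Picks k u₁ a₁ U₁ → Picks l v₁ b₁ W₁ →
  Picks k u₂ a₂ U₂ → Picks l v₂ b₂ W₂ →
  Picks k u₃ a₃ U₃ → Picks l v₃ b₃ W₃ →
  ∀ (h₁ h₂ h₃ : ℕ → ℕ → ℕ) →
  ∑< k (λ i → ∑< l (λ j → keepIf (u₁ i ∧ v₁ j) (h₁ i j)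
                        + (keepIf (u₂ i ∧ v₂ j) (h₂ i j) + keepIf (u₃ i ∧ v₃ j) (h₃ i j))))
  ≡ keepIf U₁ (keepIf W₁ (h₁ a₁ b₁))
    + (keepIf U₂ (keepIf W₂ (h₂ a₂ b₂)) + keepIf U₃ (keepIf W₃ (h₃ a₃ b₃)))
picks-∧₃ {k} {l} {u₁} {v₁} {u₂} {v₂} {u₃} {v₃} p₁ q₁ p₂ q₂ p₃ q₃ h₁ h₂ h₃ =
  trans (∑<∑<-+ k l t₁ (λ i j → t₂ i j + t₃ i j))
    (cong₂ _+_ (picks-∧ p₁ q₁ h₁)
      (trans (∑<∑<-+ k l t₂ t₃)
        (cong₂ _+_ (picks-∧ p₂ q₂ h₂) (picks-∧ p₃ q₃ h₃))))
  where
  t₁ t₂ t₃ : ℕ → ℕ → ℕ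
  t₁ i j = keepIf (u₁ i ∧ v₁ j) (h₁ i j)
  t₂ i j = keepIf (u₂ i ∧ v₂ j) (h₂ i j)
  t₃ i j = keepIf (u₃ i ∧ v₃ j) (h₃ i j)

adjacentIn : (Cell → Bool) → Tri → Tri → Bool
adjacentIn P t t' = (length (sharedCells t t') ≡ᵇ 2) ∧ bany P (sharedCells t t')

cellˣ cellʸ : Cell → Cell
cellˣ (p , q) = (suc p , q)
cellʸ (p , q) = (p , suc q)

shiftˣ shiftʸ : Tri → Tri
shiftˣ (up p q)   = up (suc p) q
shiftˣ (down p q) = down (suc p) q
shiftʸ (up p q)   = up p (suc q)
shiftʸ (down p q) = down p (suc q)

bfilter-map : (f : B → Bool) (g : A → B) (xs : List A) →
  bfilter f (map g xs) ≡ map g (bfilter (λ x → f (g x)) xs)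
bfilter-map f g []       = refl
bfilter-map f g (x ∷ xs) with f (g x)
... | true  = cong (g x ∷_) (bfilter-map f g xs)
... | false = bfilter-map f g xs

bany-map : (f : B → Bool) (g : A → B) (xs : List A) →
  bany f (map g xs) ≡ bany (λ x → f (g x)) xs
bany-map f g []       = refl
bany-map f g (x ∷ xs) = cong (f (g x) ∨_) (bany-map f g xs)

memberOf : Tri → Cell → Bool
memberOf t c = bany (cellEq c) (cellsOf t)

sharedCells-shiftˣ : ∀ t t' → sharedCells (shiftˣ t) (shiftˣ t') ≡ map cellˣ (sharedCells t t')
sharedCells-shiftˣ t@(up _ _)   t'@(up _ _)   = bfilter-map (memberOf (shiftˣ t')) cellˣ (cellsOf t)
sharedCells-shiftˣ t@(up _ _)   t'@(down _ _) = bfilter-map (memberOf (shiftˣ t')) cellˣ (cellsOf t)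
sharedCells-shiftˣ t@(down _ _) t'@(up _ _)   = bfilter-map (memberOf (shiftˣ t')) cellˣ (cellsOf t)
sharedCells-shiftˣ t@(down _ _) t'@(down _ _) = bfilter-map (memberOf (shiftˣ t')) cellˣ (cellsOf t)

sharedCells-shiftʸ : ∀ t t' → sharedCells (shiftʸ t) (shiftʸ t') ≡ map cellʸ (sharedCells t t')
sharedCells-shiftʸ t@(up _ _)   t'@(up _ _)   = bfilter-map (memberOf (shiftʸ t')) cellʸ (cellsOf t)
sharedCells-shiftʸ t@(up _ _)   t'@(down _ _) = bfilter-map (memberOf (shiftʸ t')) cellʸ (cellsOf t)
sharedCells-shiftʸ t@(down _ _) t'@(up _ _)   = bfilter-map (memberOf (shiftʸ t')) cellʸ (cellsOf t)
sharedCells-shiftʸ t@(down _ _) t'@(down _ _) = bfilter-map (memberOf (shiftʸ t')) cellʸ (cellsOf t)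

adjacentIn-map : ∀ P (g : Cell → Cell) s s' t t' → sharedCells s s' ≡ map g (sharedCells t t') →
  adjacentIn P s s' ≡ adjacentIn (λ c → P (g c)) t t'
adjacentIn-map P g s s' t t' shared
  rewrite shared | length-map g (sharedCells t t') | bany-map P g (sharedCells t t') = refl

adjacentIn-shiftˣ : ∀ P t t' →
  adjacentIn P (shiftˣ t) (shiftˣ t') ≡ adjacentIn (λ c → P (cellˣ c)) t t'
adjacentIn-shiftˣ P t t' = adjacentIn-map P cellˣ (shiftˣ t) (shiftˣ t') t t' (sharedCells-shiftˣ t t')

adjacentIn-shiftʸ : ∀ P t t' →
  adjacentIn P (shiftʸ t) (shiftʸ t') ≡ adjacentIn (λ c → P (cellʸ c)) t t'
adjacentIn-shiftʸ P t t' = adjacentIn-map P cellʸ (shiftʸ t) (shiftʸ t') t t' (sharedCells-shiftʸ t t')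

side : (Cell → Bool) → Cell → Cell → ℕ
side P c c' = b2n (bany P (c ∷ c' ∷ []))

upDownSide : (Cell → Bool) → ℕ → ℕ → ℕ → ℕ → ℕ
upDownSide P a b p q =
    keepIf ((a ≡ᵇ p) ∧ (b ≡ᵇ q)) (side P (suc a , b) (a , suc b))
  + (keepIf ((a ≡ᵇ suc p) ∧ (b ≡ᵇ q)) (side P (a , b) (a , suc b))
  + keepIf ((a ≡ᵇ p) ∧ (b ≡ᵇ suc q)) (side P (a , b) (suc a , b)))

-- Shifting both triangles reduces every pair to one with a or p zero and b or q zero; what is
-- left are finitely many configurations, since triangles two columns apart share no hexagon.
adjacentIn-up-up : ∀ P a b p q → adjacentIn P (up a b) (up p q) ≡ false
adjacentIn-up-up P (suc a) b (suc p) q =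
  trans (adjacentIn-shiftˣ P (up a b) (up p q)) (adjacentIn-up-up _ a b p q)
adjacentIn-up-up P a (suc b) p (suc q) =
  trans (adjacentIn-shiftʸ P (up a b) (up p q)) (adjacentIn-up-up _ a b p q)
adjacentIn-up-up P zero          b             (suc (suc p)) q             = refl
adjacentIn-up-up P (suc (suc a)) b             zero          q             = refl
adjacentIn-up-up P zero          zero          zero          zero          = refl
adjacentIn-up-up P zero          zero          zero          (suc zero)    = refl
adjacentIn-up-up P zero          zero          zero          (suc (suc q)) = refl
adjacentIn-up-up P zero          (suc zero)    zero          zero          = refl
adjacentIn-up-up P zero          (suc (suc b)) zero          zero          = refl
adjacentIn-up-up P zero          zero          (suc zero)    zero          = refl
adjacentIn-up-up P zero          zero          (suc zero)    (suc zero)    = refl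
adjacentIn-up-up P zero          zero          (suc zero)    (suc (suc q)) = refl
adjacentIn-up-up P zero          (suc zero)    (suc zero)    zero          = refl
adjacentIn-up-up P zero          (suc (suc b)) (suc zero)    zero          = refl
adjacentIn-up-up P (suc zero)    zero          zero          zero          = refl
adjacentIn-up-up P (suc zero)    zero          zero          (suc zero)    = refl
adjacentIn-up-up P (suc zero)    zero          zero          (suc (suc q)) = refl
adjacentIn-up-up P (suc zero)    (suc zero)    zero          zero          = refl
adjacentIn-up-up P (suc zero)    (suc (suc b)) zero          zero          = refl

adjacentIn-down-down : ∀ P a b p q → adjacentIn P (down a b) (down p q) ≡ false
adjacentIn-down-down P (suc a) b (suc p) q =
  trans (adjacentIn-shiftˣ P (down a b) (down p q)) (adjacentIn-down-down _ a b p q)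
adjacentIn-down-down P a (suc b) p (suc q) =
  trans (adjacentIn-shiftʸ P (down a b) (down p q)) (adjacentIn-down-down _ a b p q)
adjacentIn-down-down P zero          b             (suc (suc p)) q             = refl
adjacentIn-down-down P (suc (suc a)) b             zero          q             = refl
adjacentIn-down-down P zero          zero          zero          zero          = refl
adjacentIn-down-down P zero          zero          zero          (suc zero)    = refl
adjacentIn-down-down P zero          zero          zero          (suc (suc q)) = refl
adjacentIn-down-down P zero          (suc zero)    zero          zero          = refl
adjacentIn-down-down P zero          (suc (suc b)) zero          zero          = refl
adjacentIn-down-down P zero          zero          (suc zero)    zero          = refl
adjacentIn-down-down P zero          zero          (suc zero)    (suc zero)    = refl
adjacentIn-down-down P zero          zero          (suc zero)    (suc (suc q)) = refl
adjacentIn-down-down P zero          (suc zero)    (suc zero)    zero          = refl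
adjacentIn-down-down P zero          (suc (suc b)) (suc zero)    zero          = refl
adjacentIn-down-down P (suc zero)    zero          zero          zero          = refl
adjacentIn-down-down P (suc zero)    zero          zero          (suc zero)    = refl
adjacentIn-down-down P (suc zero)    zero          zero          (suc (suc q)) = refl
adjacentIn-down-down P (suc zero)    (suc zero)    zero          zero          = refl
adjacentIn-down-down P (suc zero)    (suc (suc b)) zero          zero          = refl

adjacentIn-up-down : ∀ P a b p q → b2n (adjacentIn P (up a b) (down p q)) ≡ upDownSide P a b p q
adjacentIn-up-down P (suc a) b (suc p) q =
  trans (cong b2n (adjacentIn-shiftˣ P (up a b) (down p q))) (adjacentIn-up-down _ a b p q)
adjacentIn-up-down P a (suc b) p (suc q) =
  trans (cong b2n (adjacentIn-shiftʸ P (up a b) (down p q))) (adjacentIn-up-down _ a b p q)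
adjacentIn-up-down P zero          b             (suc (suc p)) q             = refl
adjacentIn-up-down P (suc (suc a)) b             zero          q             = refl
adjacentIn-up-down P zero          zero          zero          zero          = sym (+-identityʳ _)
adjacentIn-up-down P zero          zero          zero          (suc zero)    = refl
adjacentIn-up-down P zero          zero          zero          (suc (suc q)) = refl
adjacentIn-up-down P zero          (suc zero)    zero          zero          = refl
adjacentIn-up-down P zero          (suc (suc b)) zero          zero          = refl
adjacentIn-up-down P zero          zero          (suc zero)    zero          = refl
adjacentIn-up-down P zero          zero          (suc zero)    (suc zero)    = refl
adjacentIn-up-down P zero          zero          (suc zero)    (suc (suc q)) = refl
adjacentIn-up-down P zero          (suc zero)    (suc zero)    zero          = refl
adjacentIn-up-down P zero          (suc (suc b)) (suc zero)    zero          = refl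
adjacentIn-up-down P (suc zero)    zero          zero          zero          = sym (+-identityʳ _)
adjacentIn-up-down P (suc zero)    zero          zero          (suc zero)    = refl
adjacentIn-up-down P (suc zero)    zero          zero          (suc (suc q)) = refl
adjacentIn-up-down P (suc zero)    (suc zero)    zero          zero          = refl
adjacentIn-up-down P (suc zero)    (suc (suc b)) zero          zero          = refl

adjacentIn-down-up : ∀ P a b p q → b2n (adjacentIn P (down p q) (up a b)) ≡ upDownSide P a b p q
adjacentIn-down-up P (suc a) b (suc p) q =
  trans (cong b2n (adjacentIn-shiftˣ P (down p q) (up a b))) (adjacentIn-down-up _ a b p q)
adjacentIn-down-up P a (suc b) p (suc q) =
  trans (cong b2n (adjacentIn-shiftʸ P (down p q) (up a b))) (adjacentIn-down-up _ a b p q)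
adjacentIn-down-up P zero          b             (suc (suc p)) q             = refl
adjacentIn-down-up P (suc (suc a)) b             zero          q             = refl
adjacentIn-down-up P zero          zero          zero          zero          = sym (+-identityʳ _)
adjacentIn-down-up P zero          zero          zero          (suc zero)    = refl
adjacentIn-down-up P zero          zero          zero          (suc (suc q)) = refl
adjacentIn-down-up P zero          (suc zero)    zero          zero          = refl
adjacentIn-down-up P zero          (suc (suc b)) zero          zero          = refl
adjacentIn-down-up P zero          zero          (suc zero)    zero          = refl
adjacentIn-down-up P zero          zero          (suc zero)    (suc zero)    = refl
adjacentIn-down-up P zero          zero          (suc zero)    (suc (suc q)) = refl
adjacentIn-down-up P zero          (suc zero)    (suc zero)    zero          = refl
adjacentIn-down-up P zero          (suc (suc b)) (suc zero)    zero          = refl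
adjacentIn-down-up P (suc zero)    zero          zero          zero          = sym (+-identityʳ _)
adjacentIn-down-up P (suc zero)    zero          zero          (suc zero)    = refl
adjacentIn-down-up P (suc zero)    zero          zero          (suc (suc q)) = refl
adjacentIn-down-up P (suc zero)    (suc zero)    zero          zero          = refl
adjacentIn-down-up P (suc zero)    (suc (suc b)) zero          zero          = refl

b2n-injective : ∀ u v → b2n u ≡ b2n v → u ≡ v
b2n-injective true  true  _ = refl
b2n-injective false false _ = refl

isUp : Tri → Bool
isUp (up _ _)   = true
isUp (down _ _) = false

adjacentIn-sym : ∀ P t t' → adjacentIn P t t' ≡ adjacentIn P t' t
adjacentIn-sym P (up a b)   (up p q)   =
  trans (adjacentIn-up-up P a b p q) (sym (adjacentIn-up-up P p q a b))
adjacentIn-sym P (down a b) (down p q) =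
  trans (adjacentIn-down-down P a b p q) (sym (adjacentIn-down-down P p q a b))
adjacentIn-sym P (up a b)   (down p q) =
  b2n-injective _ _ (trans (adjacentIn-up-down P a b p q) (sym (adjacentIn-down-up P a b p q)))
adjacentIn-sym P (down p q) (up a b)   =
  b2n-injective _ _ (trans (adjacentIn-down-up P a b p q) (sym (adjacentIn-up-down P a b p q)))

adjacentIn-bipartite : ∀ P t t' → isUp t ≡ isUp t' → adjacentIn P t t' ≡ false
adjacentIn-bipartite P (up a b)   (up p q)   _ = adjacentIn-up-up P a b p q
adjacentIn-bipartite P (down a b) (down p q) _ = adjacentIn-down-down P a b p q

cellEq⇒≡ : ∀ c c' → T (cellEq c c') → c ≡ c'
cellEq⇒≡ (a , b) (a' , b') eq with to T-∧ eq
... | a≡a' , b≡b' = cong₂ _,_ (≡ᵇ⇒≡ a a' a≡a') (≡ᵇ⇒≡ b b' b≡b')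

bany-∈ : ∀ (P : Cell → Bool) c cs → T (bany (cellEq c) cs) → T (P c) → T (bany P cs)
bany-∈ P c (c' ∷ cs) c∈ Pc with to T-∨ c∈
... | inj₁ c≡c' = from T-∨ (inj₁ (subst (λ d → T (P d)) (cellEq⇒≡ c c' c≡c') Pc))
... | inj₂ c∈cs = from T-∨ (inj₂ (bany-∈ P c cs c∈cs Pc))

bany-bfilter-∈ : ∀ (P : Cell → Bool) cs cs' →
  T (bany P (bfilter (λ c → bany (cellEq c) cs') cs)) → T (bany P cs')
bany-bfilter-∈ P (c ∷ cs) cs' h with bany (cellEq c) cs' in c∈
... | false = bany-bfilter-∈ P cs cs' h
... | true with to T-∨ h
...   | inj₁ Pc = bany-∈ P c cs' (from T-≡ c∈) Pc
...   | inj₂ h′ = bany-bfilter-∈ P cs cs' h′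

adjacentIn⇒corner : ∀ P t t' → T (adjacentIn P t t') → T (bany P (cellsOf t'))
adjacentIn⇒corner P t t' adj = bany-bfilter-∈ P (cellsOf t) (cellsOf t') (proj₂ (to T-∧ adj))

corner-*-adjacentIn : ∀ P t t' →
  b2n (bany P (cellsOf t')) * b2n (adjacentIn P t t') ≡ b2n (adjacentIn P t t')
corner-*-adjacentIn P t t' with adjacentIn P t t' in adj
... | false = *-zeroʳ (b2n (bany P (cellsOf t')))
... | true rewrite to T-≡ (adjacentIn⇒corner P t t' (from T-≡ adj)) = refl

-- The tests on a coordinate p, with patch bound k and grid bound k + 2, that the degrees use.
record Profile : Set where
  constructor profile
  field
    pos le lt inRange predInRange sucInRange : Bool

profileOf : ℕ → ℕ → Profile
profileOf k p = profile (1 ≤ᵇ p) (p ≤ᵇ k) (p <ᵇ k)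
  (p <ᵇ suc (suc k)) ((1 ≤ᵇ p) ∧ (p ≤ᵇ suc (suc k))) (suc p <ᵇ suc (suc k))

before inner last beyond : Profile
before = profile false true  true  true false true
inner  = profile true  true  true  true true true
last   = profile true  true  false true true true
beyond = profile true  false false true true false

profileOf-inner : ∀ {k i} → i < k → profileOf (suc k) (suc i) ≡ inner
profileOf-inner {suc k} {zero}  _         = refl
profileOf-inner {suc k} {suc i} (s≤s i<k) = profileOf-inner i<k

profileOf-last : ∀ k → profileOf (suc k) (suc k) ≡ last
profileOf-last zero    = refl
profileOf-last (suc k) = profileOf-last k

profileOf-beyond : ∀ k → profileOf (suc k) (suc (suc k)) ≡ beyond
profileOf-beyond zero    = refl
profileOf-beyond (suc k) = profileOf-beyond k

∑<-zones : ∀ k (h : Profile → ℕ) →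
  ∑< (3 + k) (λ p → h (profileOf (suc k) p)) ≡ h before + (k * h inner + h last + h beyond)
∑<-zones k h = cong (h before +_) (begin
  ∑< (2 + k) g               ≡⟨ ∑<-suc (suc k) g ⟩
  ∑< (1 + k) g + g (suc k)   ≡⟨ cong (_+ g (suc k)) (∑<-suc k g) ⟩
  ∑< k g + g k + g (suc k)   ≡⟨ cong₂ _+_ (cong₂ _+_ inner-zone (cong h (profileOf-last k)))
                                         (cong h (profileOf-beyond k)) ⟩
  k * h inner + h last + h beyond ∎)
  where
  g : ℕ → ℕ
  g i = h (profileOf (suc k) (suc i))
  inner-zone : ∑< k g ≡ k * h inner
  inner-zone = ∑<-const k g (h inner) (λ _ i<k → cong h (profileOf-inner i<k))

-- C(deg, 2) summed over the corners up (p , q) and down (p , q), read off the profiles of p and q;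
-- hᵢⱼ says that hexagon (p + i , q + j) is in the patch.  The shape (∨ false, + 0) follows the
-- unfolding of isVertex and ∑-allTris, which makes ∑C2≡∑centredPaths hold cell by cell.
centredPaths : Profile → Profile → ℕ
centredPaths x y =
    b2n (h₀₀ ∨ (h₁₀ ∨ (h₀₁ ∨ false))) * (upDegree C 2)
  + (b2n (h₁₀ ∨ (h₀₁ ∨ (h₁₁ ∨ false))) * (downDegree C 2) + 0)
  where
  open Profile
  h₀₀ h₁₀ h₀₁ h₁₁ : Bool
  h₀₀ = pos x ∧ (le x ∧ (pos y ∧ le y))
  h₁₀ = lt x ∧ (pos y ∧ le y)
  h₀₁ = pos x ∧ (le x ∧ lt y)
  h₁₁ = lt x ∧ lt y
  sideOf : Bool → Bool → ℕ
  sideOf h h′ = b2n (h ∨ (h′ ∨ false))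
  upDegree downDegree : ℕ
  upDegree =
      keepIf (inRange x) (keepIf (inRange y) (sideOf h₁₀ h₀₁))
    + (keepIf (predInRange x) (keepIf (inRange y) (sideOf h₀₀ h₀₁))
    + keepIf (inRange x) (keepIf (predInRange y) (sideOf h₀₀ h₁₀)))
  downDegree =
      keepIf (inRange x) (keepIf (inRange y) (sideOf h₁₀ h₀₁))
    + (keepIf (sucInRange x) (keepIf (inRange y) (sideOf h₁₀ h₁₁))
    + keepIf (inRange x) (keepIf (sucInRange y) (sideOf h₀₁ h₁₁)))

module Honeycomb (m n : ℕ) where

  P : Cell → Bool
  P = inPatch m n

  V : List Tri
  V = vertices m n

  M N : ℕ
  M = suc (suc m)
  N = suc (suc n)

  open BipartiteGraph (adjacent m n) isUp (adjacentIn-sym P) (adjacentIn-bipartite P)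

  δ≡∑C2 : δ m n ≡ ∑ V (λ v → degree V v C 2)
  δ≡∑C2 = begin
    length (bfilter (inducesP3 m n) (combinations 3 V))
      ≡⟨ length-bfilter (inducesP3 m n) (combinations 3 V) ⟩
    ∑ (combinations 3 V) (λ l → b2n (inducesP3 m n l))
      ≡⟨ ∑-combinations₃ V (λ l → b2n (inducesP3 m n l)) ⟩
    ∑triples V (λ x y z → b2n (twoEdges x y z))
      ≡⟨ pathCount V ⟩
    ∑ V (λ v → degree V v C 2) ∎

  ∑-allTris : ∀ (F : Tri → ℕ) →
    ∑ (allTris m n) F ≡ ∑< M (λ p → ∑< N (λ q → F (up p q) + (F (down p q) + 0)))
  ∑-allTris F = begin
    ∑ (concatMap column (upTo M)) F  ≡⟨ ∑-concatMap column (upTo M) F ⟩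
    ∑ (upTo M) (λ p → ∑ (column p) F) ≡⟨ ∑-applyUpTo M id (λ p → ∑ (column p) F) ⟩
    ∑< M (λ p → ∑ (column p) F)      ≡⟨ ∑<-cong M (λ p → trans (∑-concatMap (pair p) (upTo N) F)
                                                               (∑-applyUpTo N id (λ q → ∑ (pair p q) F))) ⟩
    ∑< M (λ p → ∑< N (λ q → F (up p q) + (F (down p q) + 0))) ∎
    where
    pair : ℕ → ℕ → List Tri
    pair p q = up p q ∷ down p q ∷ []
    column : ℕ → List Tri
    column p = concatMap (pair p) (upTo N)

  degree-grid : ∀ t → degree V t ≡ ∑< M (λ p → ∑< N (λ q → e t (up p q) + (e t (down p q) + 0)))
  degree-grid t = begin
    ∑ V (e t)                                               ≡⟨ ∑-bfilter (isVertex m n) (allTris m n) (e t) ⟩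
    ∑ (allTris m n) (λ t' → b2n (isVertex m n t') * e t t') ≡⟨ ∑-cong (allTris m n) (corner-*-adjacentIn P t) ⟩
    ∑ (allTris m n) (e t)                                   ≡⟨ ∑-allTris (e t) ⟩
    ∑< M (λ p → ∑< N (λ q → e t (up p q) + (e t (down p q) + 0))) ∎

  degree-up : ∀ a b → degree V (up a b) ≡
      keepIf (a <ᵇ M) (keepIf (b <ᵇ N) (side P (suc a , b) (a , suc b)))
    + (keepIf ((1 ≤ᵇ a) ∧ (a ≤ᵇ M)) (keepIf (b <ᵇ N) (side P (a , b) (a , suc b)))
    + keepIf (a <ᵇ M) (keepIf ((1 ≤ᵇ b) ∧ (b ≤ᵇ N)) (side P (a , b) (suc a , b))))
  degree-up a b = begin
    degree V (up a b)
      ≡⟨ degree-grid (up a b) ⟩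
    ∑< M (λ p → ∑< N (λ q → e (up a b) (up p q) + (e (up a b) (down p q) + 0)))
      ≡⟨ ∑<-cong M (λ p → ∑<-cong N (λ q → trans
           (cong₂ (λ u d → b2n u + (d + 0)) (adjacentIn-up-up P a b p q) (adjacentIn-up-down P a b p q))
           (+-identityʳ _))) ⟩
    ∑< M (λ p → ∑< N (upDownSide P a b p))
      ≡⟨ picks-∧₃ (picks-≡ᵇ M a) (picks-≡ᵇ N b) (picks-pred M a) (picks-≡ᵇ N b)
                  (picks-≡ᵇ M a) (picks-pred N b)
                  (λ _ _ → side P (suc a , b) (a , suc b)) (λ _ _ → side P (a , b) (a , suc b))
                  (λ _ _ → side P (a , b) (suc a , b)) ⟩
    _ ∎

  degree-down : ∀ a b → degree V (down a b) ≡
      keepIf (a <ᵇ M) (keepIf (b <ᵇ N) (side P (suc a , b) (a , suc b)))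
    + (keepIf (suc a <ᵇ M) (keepIf (b <ᵇ N) (side P (suc a , b) (suc a , suc b)))
    + keepIf (a <ᵇ M) (keepIf (suc b <ᵇ N) (side P (a , suc b) (suc a , suc b))))
  degree-down a b = begin
    degree V (down a b)
      ≡⟨ degree-grid (down a b) ⟩
    ∑< M (λ p → ∑< N (λ q → e (down a b) (up p q) + (e (down a b) (down p q) + 0)))
      ≡⟨ ∑<-cong M (λ p → ∑<-cong N (λ q → trans
           (cong₂ (λ u d → u + (b2n d + 0)) (adjacentIn-down-up P p q a b) (adjacentIn-down-down P a b p q))
           (+-identityʳ _))) ⟩
    ∑< M (λ p → ∑< N (λ q → upDownSide P p q a b))
      ≡⟨ picks-∧₃ (picks-ᵇ≡ M a) (picks-ᵇ≡ N b) (picks-ᵇ≡ M (suc a)) (picks-ᵇ≡ N b)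
                  (picks-ᵇ≡ M a) (picks-ᵇ≡ N (suc b))
                  (λ p q → side P (suc p , q) (p , suc q)) (λ p q → side P (p , q) (p , suc q))
                  (λ p q → side P (p , q) (suc p , q)) ⟩
    _ ∎

  ∑C2≡∑centredPaths :
    ∑ V (λ v → degree V v C 2) ≡ ∑< M (λ p → ∑< N (λ q → centredPaths (profileOf m p) (profileOf n q)))
  ∑C2≡∑centredPaths = begin
    ∑ V (λ v → degree V v C 2)
      ≡⟨ ∑-bfilter (isVertex m n) (allTris m n) (λ v → degree V v C 2) ⟩
    ∑ (allTris m n) (λ v → b2n (isVertex m n v) * (degree V v C 2))
      ≡⟨ ∑-allTris (λ v → b2n (isVertex m n v) * (degree V v C 2)) ⟩
    _ ≡⟨ ∑<-cong M (λ p → ∑<-cong N (λ q →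
           cong₂ (λ u d → b2n (isVertex m n (up p q)) * (u C 2)
                          + (b2n (isVertex m n (down p q)) * (d C 2) + 0))
                 (degree-up p q) (degree-down p q))) ⟩
    ∑< M (λ p → ∑< N (λ q → centredPaths (profileOf m p) (profileOf n q))) ∎

-- The numerals are the values of centredPaths on the sixteen pairs of zones.
zoneTable-sum : ∀ a b →
    (1 + (b * 4 + 2 + 0)) + (a * (4 + (b * 6 + 4 + 0)) + (2 + (b * 4 + 1 + 0)) + (0 + (b * 0 + 0 + 0)))
  ≡ 6 * a * b + 8 * a + 8 * b + 6
zoneTable-sum = solve-∀

∑centredPaths-closedForm : ∀ a b →
  ∑< (3 + a) (λ p → ∑< (3 + b) (λ q → centredPaths (profileOf (suc a) p) (profileOf (suc b) q)))
  ≡ 6 * a * b + 8 * a + 8 * b + 6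
∑centredPaths-closedForm a b = begin
  ∑< (3 + a) (λ p → row (profileOf (suc a) p))
    ≡⟨ ∑<-zones a row ⟩
  row before + (a * row inner + row last + row beyond)
    ≡⟨ cong₂ _+_ (rowSum before)
                 (cong₂ _+_ (cong₂ _+_ (cong (a *_) (rowSum inner)) (rowSum last)) (rowSum beyond)) ⟩
  _ ≡⟨ zoneTable-sum a b ⟩
  6 * a * b + 8 * a + 8 * b + 6 ∎
  where
  row : Profile → ℕ
  row x = ∑< (3 + b) (λ q → centredPaths x (profileOf (suc b) q))
  rowSum : ∀ x → row x ≡ centredPaths x before
                       + (b * centredPaths x inner + centredPaths x last + centredPaths x beyond)
  rowSum x = ∑<-zones b (centredPaths x)

closedForm-+4 : ∀ a b →
  6 * a * b + 8 * a + 8 * b + 6 + 4 ≡ 6 * suc a * suc b + 2 * suc a + 2 * suc b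
closedForm-+4 = solve-∀

mainTheorem3 : (m n : ℕ) → m ≥ 1 → n ≥ 1 →
    δ m n ≡ (6 * m * n + 2 * m + 2 * n) ∸ 4
mainTheorem3 (suc a) (suc b) _ _ = begin
  δ (suc a) (suc b)
    ≡⟨ trans δ≡∑C2 ∑C2≡∑centredPaths ⟩
  ∑< (3 + a) (λ p → ∑< (3 + b) (λ q → centredPaths (profileOf (suc a) p) (profileOf (suc b) q)))
    ≡⟨ ∑centredPaths-closedForm a b ⟩
  6 * a * b + 8 * a + 8 * b + 6
    ≡⟨ m+n∸n≡m _ 4 ⟨
  6 * a * b + 8 * a + 8 * b + 6 + 4 ∸ 4
    ≡⟨ cong (_∸ 4) (closedForm-+4 a b) ⟩
  (6 * suc a * suc b + 2 * suc a + 2 * suc b) ∸ 4 ∎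
  where open Honeycomb (suc a) (suc b)
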